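{- Let $G$ be a feasible graph. Then the election index $\phi(G)$ of $G$ equals the smallest integer $\ell\ge 0$ such that the augmented truncated views $\mathcal{B}^{\ell}(v)$ at depth $\ell$ of all nodes $v$ of $G$ are pairwise distinct.
   Context: A graph is a simple undirected connected graph with $n\ge 3$ anonymous (unlabeled) nodes; at each node $v$ of degree $d$, the $d$ incident edges carry distinct port numbers $0,\dots,d-1$ (port numbering is local: the two port numbers of an edge at its two endpoints are unrelated). The truncated view $\mathcal{V}^l(v)$ is defined inductively: $\mathcal{V}^0(v)$ is a single node $x_0$; $\mathcal{V}^{l+1}(v)$ is the port-labeled tree rooted at $x_0$ having, for each neighbor $v_i$ of $v$, a child $x_i$ of $x_0$ such that the port at $x_0$ of edge $\{x_0,x_i\}$ equals the port at $v$ of edge $\{v,v_i\}$ and the port at $x_i$ equals the port at $v_i$ of that edge, and $x_i$ is the root of a copy of $\mathcal{V}^l(v_i)$. The view $\mathcal{V}(v)$ is the infinite tree whose truncation to depth $l$ is $\mathcal{V}^l(v)$ for every $l$. The augmented truncated view $\mathcal{B}^l(v)$ is $\mathcal{V}^l(v)$ with each leaf labeled by the degree (in the graph) of the node it represents. A graph is feasible if the views $\mathcal{V}(v)$ of all its nodes are pairwise distinct. Computation model (LOCAL): synchronous rounds, all nodes start simultaneously; in each round every node exchanges arbitrary messages with all its neighbors and performs arbitrary local computation; initially each node knows only its own degree. Leader election: every node $v$ must output a sequence $(p_1,q_1,\dots,p_k,q_k)$ of nonnegative integers such that the path starting at $v$ whose $i$-th edge has port $p_i$ at its endpoint nearer to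 $v$ and port $q_i$ at its other endpoint is a simple path of the graph, and all these paths (over all nodes $v$) end at a common node (the leader). The time of an algorithm is the number of rounds until all nodes have output. The election index $\phi(G)$ of a feasible graph $G$ is the minimum time in which leader election can be performed in $G$ by a deterministic algorithm when every node is given the map of $G$ (an isomorphic copy of $G$ with all port numbers indicated). -}

module Defs where

open import Data.Nat using (ℕ; zero; suc; _≤_; _<_)
open import Data.Fin using (Fin; toℕ)
open import Data.List using (List; []; _∷_; map; allFin)
open import Data.Maybe using (Maybe; just; nothing)
open import Data.Product using (_×_; _,_; Σ; ∃; ∃-syntax)
open import Data.List.Relation.Unary.Unique.Propositional using (Unique)
open import Relation.Binary.PropositionalEquality using (_≡_; _≢_)

-- Node v has degree deg v; its incident edges carry ports Fin (deg v).
-- nbr v p is the neighbour reached through port p of v, and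
-- bport v p is the port of that same edge at the other endpoint.

record PortGraph : Set where
  field
    n          : ℕ
    deg        : Fin n → ℕ
    nbr        : (v : Fin n) → Fin (deg v) → Fin n
    bport      : (v : Fin n) (p : Fin (deg v)) → Fin (deg (nbr v p))
    nbr-back   : ∀ v p → nbr (nbr v p) (bport v p) ≡ v
    bport-back : ∀ v p → toℕ (bport (nbr v p) (bport v p)) ≡ toℕ p

module _ (G : PortGraph) where
  open PortGraph G

  Simple : Set
  Simple = (∀ v p → nbr v p ≢ v) × (∀ v p p′ → nbr v p ≡ nbr v p′ → p ≡ p′)

  data Reach : Fin n → Fin n → Set where
    here : ∀ {v} → Reach v v
    step : ∀ {v w} (p : Fin (deg v)) → Reach (nbr v p) w → Reach v w

  Connected : Set
  Connected = ∀ u v → Reach u v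

  -- A node is given by the list of its children, ordered by the port at
  -- the parent (the i-th entry corresponds to port i); each entry records
  -- the port at the child and the subtree rooted at the child.
  -- Leaves: 'leaf' (unlabelled) or 'dleaf d' (labelled by the degree d).

module _ where
  data Tree : Set where
    leaf  : Tree
    dleaf : ℕ → Tree
    node  : List (ℕ × Tree) → Tree

module _ (G : PortGraph) where
  open PortGraph G

  view : ℕ → Fin n → Tree
  view zero    v = leaf
  view (suc l) v = node (map (λ p → toℕ (bport v p) , view l (nbr v p)) (allFin (deg v)))

  augView : ℕ → Fin n → Tree
  augView zero    v = dleaf (deg v)
  augView (suc l) v = node (map (λ p → toℕ (bport v p) , augView l (nbr v p)) (allFin (deg v)))

  -- feasible: the (infinite) views of distinct nodes differ; two infinite
  -- views coincide iff all their truncations coincide.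
  Feasible : Set
  Feasible = ∀ u v → (∀ l → view l u ≡ view l v) → u ≡ v

  AugDistinct : ℕ → Set
  AugDistinct l = ∀ u v → augView l u ≡ augView l v → u ≡ v

  data PortPath : Fin n → List (ℕ × ℕ) → List (Fin n) → Fin n → Set where
    stop : ∀ {v} → PortPath v [] (v ∷ []) v
    step : ∀ {v ps vs w} (p : Fin (deg v)) →
           PortPath (nbr v p) ps vs w →
           PortPath v ((toℕ p , toℕ (bport v p)) ∷ ps) (v ∷ vs) w

  SimplePathTo : Fin n → List (ℕ × ℕ) → Fin n → Set
  SimplePathTo v ps w = ∃[ vs ] (PortPath v ps vs w × Unique vs)

-- Deterministic algorithms in the LOCAL model for anonymous networks.
-- Each node holds a state (initially a function of its degree only);
-- in each round it sends on each of its ports p the message send s p,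
-- then updates its state from the list of received messages, indexed by
-- its own port on which each message arrived.  A node outputs at the
-- first round r at which output applied to its state is defined.

record Algorithm : Set₁ where
  field
    State   : Set
    Msg     : Set
    init    : ℕ → State
    send    : State → ℕ → Msg
    receive : State → List Msg → State
    output  : State → Maybe (List (ℕ × ℕ))

module _ (G : PortGraph) (A : Algorithm) where
  open PortGraph G
  open Algorithm A

  stateAt : ℕ → Fin n → State
  stateAt zero    v = init (deg v)
  stateAt (suc r) v =
    receive (stateAt r v)
            (map (λ p → send (stateAt r (nbr v p)) (toℕ (bport v p))) (allFin (deg v)))

  OutputsAt : Fin n → ℕ → List (ℕ × ℕ) → Set
  OutputsAt v r o = output (stateAt r v) ≡ just o
                  × (∀ r′ → r′ < r → output (stateAt r′ v) ≡ nothing)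

  ElectsWithin : ℕ → Set
  ElectsWithin t = ∃[ leader ] ∀ v → ∃[ r ] ∃[ o ]
                     (r ≤ t × OutputsAt v r o × SimplePathTo G v o leader)

ElectionIndexIs : PortGraph → ℕ → Set₁
ElectionIndexIs G t = (∃[ A ] ElectsWithin G A t)
                    × (∀ (A : Algorithm) t′ → ElectsWithin G A t′ → t ≤ t′)

LeastAugDistinct : PortGraph → ℕ → Set
LeastAugDistinct G l = AugDistinct G l × (∀ l′ → AugDistinct G l′ → l ≤ l′)

-- In t rounds a node can learn exactly its augmented view B^t(v), and its
-- state after t rounds of any algorithm is a function of B^t(v).  So if
-- B^t(u) = B^t(v) for u ≠ v, the two nodes output the same port sequence,
-- which cannot lead both of them to the same leader; conversely, once all
-- B^l(v) are distinct, each node recognises itself from B^l(v) and outputs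
-- a path from the map.  A depth l with distinct B^l exists: the partitions
-- of the nodes by B^l refine each other, so they stabilise within n² steps,
-- and after stabilising they coincide with the partition by infinite views,
-- which is discrete by feasibility.

module Submission where

open import Defs
open import Data.Nat using (ℕ; _≤_)
open import Data.Product using (_×_; ∃-syntax)

open import Level using (Level)
open import Data.Nat as ℕ using (zero; suc; _<_; _+_; _≤′_; z≤n; s≤s)
import Data.Nat.Properties as ℕ
open import Data.Fin as Fin using (Fin; toℕ)
open import Data.Fin.Properties using (any?; all?; toℕ-injective)
open import Data.List using (List; []; _∷_; map; filter; length; allFin; cartesianProduct)
open import Data.List.Properties using (map-cong; map-∘; length-map; length-tabulate; ∷-dec; ∷-injective)
open import Data.List.Membership.Propositional using (_∈_)
open import Data.List.Membership.Propositional.Properties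
  using (∈-allFin; ∈-cartesianProduct⁺; ∈-filter⁺; ∈-filter⁻)
open import Data.List.Membership.DecPropositional using (_∈?_)
open import Data.List.Relation.Unary.Any using (here; there)
import Data.List.Relation.Unary.All as All
open import Data.List.Relation.Unary.All.Properties using (¬Any⇒All¬)
open import Data.List.Relation.Unary.Unique.Propositional using (Unique; []; _∷_)
open import Data.List.Relation.Binary.Sublist.Propositional as Sublist using (⊆-refl)
open import Data.List.Relation.Binary.Sublist.Propositional.Properties using (filter⁺)
open import Data.List.Relation.Binary.Sublist.Heterogeneous.Properties using (length-mono-≤; toPointwise)
open import Data.List.Relation.Binary.Pointwise using (Pointwise-≡⇒≡)
open import Data.Maybe using (Maybe; just; nothing)
open import Data.Maybe.Properties using (just-injective)
open import Data.Product using (∃; _,_; proj₁; proj₂; map₂)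
open import Data.Sum using (inj₁; inj₂)
open import Function using (_∘_; id)
open import Relation.Nullary using (Dec; yes; no; ¬_; contradiction)
open import Relation.Nullary.Decidable using (map′; _×-dec_; _→-dec_)
open import Relation.Unary using (Pred; Decidable; _⊆_)
open import Relation.Binary.Definitions using (DecidableEquality; tri<; tri≈; tri>)
open import Relation.Binary.PropositionalEquality

private
  variable
    a p q : Level
    A B C : Set a
    l m r t : ℕ

cong-through : {h : A → B} {g : A → C} (f : B → C) → (∀ x → f (h x) ≡ g x) →
               ∀ {x y} → h x ≡ h y → g x ≡ g y
cong-through {h = h} {g} f f∘h≗g {x} {y} hx≡hy = begin
  g x      ≡⟨ f∘h≗g x ⟨
  f (h x)  ≡⟨ cong f hx≡hy ⟩
  f (h y)  ≡⟨ f∘h≗g y ⟩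
  g y      ∎
  where open ≡-Reasoning

module _ {P : Pred A p} {Q : Pred A q} (P? : Decidable P) (Q? : Decidable Q) (Q⊆P : Q ⊆ P) where

  private
    filter-sublist : ∀ xs → filter Q? xs Sublist.⊆ filter P? xs
    filter-sublist xs = filter⁺ Q? P? (λ { refl → Q⊆P }) (⊆-refl {x = xs})

  length-filter-mono : ∀ xs → length (filter Q? xs) ≤ length (filter P? xs)
  length-filter-mono xs = length-mono-≤ (filter-sublist xs)

  length-filter-≡⇒⊇ : ∀ {xs x} → length (filter Q? xs) ≡ length (filter P? xs) →
                      x ∈ xs → P x → Q x
  length-filter-≡⇒⊇ {xs} eq x∈xs px =
    proj₂ (∈-filter⁻ Q? {xs = xs} (subst (_ ∈_) (sym filters≡) (∈-filter⁺ P? x∈xs px)))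
    where
    filters≡ : filter Q? xs ≡ filter P? xs
    filters≡ = Pointwise-≡⇒≡ (toPointwise eq (filter-sublist xs))

module _ {P : Pred ℕ p} (P? : Decidable P) where

  least-witness : P m → ∃[ l ] (P l × (∀ l′ → P l′ → l ≤ l′))
  least-witness {m} pm = search m 0 (λ ()) (subst P (sym (ℕ.+-identityʳ m)) pm)
    where
    search : ∀ k i → (∀ {j} → j < i → ¬ P j) → P (k + i) → ∃[ l ] (P l × (∀ l′ → P l′ → l ≤ l′))
    search k i below pk with P? i
    ... | yes pi = i , pi , λ l′ pl′ → ℕ.≮⇒≥ (λ l′<i → below l′<i pl′)
    search zero    i below pk | no ¬pi = contradiction pk ¬pi
    search (suc k) i below pk | no ¬pi = search k (suc i) below′ (subst P (sym (ℕ.+-suc k i)) pk)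
      where
      below′ : ∀ {j} → j < suc i → ¬ P j
      below′ j<1+i with ℕ.m<1+n⇒m<n∨m≡n j<1+i
      ... | inj₁ j<i  = below j<i
      ... | inj₂ refl = ¬pi

mutual
  _≟ᵀ_ : DecidableEquality Tree
  leaf    ≟ᵀ leaf    = yes refl
  dleaf d ≟ᵀ dleaf e = map′ (cong dleaf) (λ { refl → refl }) (d ℕ.≟ e)
  node cs ≟ᵀ node ds = map′ (cong node) (λ { refl → refl }) (cs ≟ᶜ ds)
  leaf    ≟ᵀ dleaf _ = no λ ()
  leaf    ≟ᵀ node _  = no λ ()
  dleaf _ ≟ᵀ leaf    = no λ ()
  dleaf _ ≟ᵀ node _  = no λ ()
  node _  ≟ᵀ leaf    = no λ ()
  node _  ≟ᵀ dleaf _ = no λ ()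

  _≟ᶜ_ : DecidableEquality (List (ℕ × Tree))
  []             ≟ᶜ []             = yes refl
  ((q , t) ∷ cs) ≟ᶜ ((r , s) ∷ ds) =
    ∷-dec (map′ (λ { (refl , refl) → refl }) (λ { refl → refl , refl }) (q ℕ.≟ r ×-dec t ≟ᵀ s))
          (cs ≟ᶜ ds)
  []             ≟ᶜ (_ ∷ _)        = no λ ()
  (_ ∷ _)        ≟ᶜ []             = no λ ()

mapChildren : (Tree → Tree) → Tree → Tree
mapChildren h (node cs) = node (map (map₂ h) cs)
mapChildren h t         = t

truncate : ℕ → Tree → Tree
truncate zero    (node cs) = dleaf (length cs)
truncate zero    t         = t
truncate (suc l) t         = mapChildren (truncate l) t

eraseLabels : ℕ → Tree → Tree
eraseLabels zero    t = leaf
eraseLabels (suc l) t = mapChildren (eraseLabels l) t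

module _ (A : Algorithm) where
  open Algorithm A

  -- The last clause is a junk value: it is never reached on augmented views.
  stateFromAugView : ℕ → Tree → State
  stateFromAugView zero    (dleaf d) = init d
  stateFromAugView (suc r) (node cs) =
    receive (stateFromAugView r (truncate r (node cs)))
            (map (λ (q , s) → send (stateFromAugView r s) q) cs)
  stateFromAugView _       _         = init 0

module _ (G : PortGraph) where
  open PortGraph G

  private
    variable
      u v w : Fin n

  owner? : ∀ l t → Dec (∃ λ w → augView G l w ≡ t)
  owner? l t = any? (λ w → augView G l w ≟ᵀ t)

  mapChildren-augView : (h : Tree → Tree) (f : Fin n → Tree) →
    (∀ w → h (augView G l w) ≡ f w) → ∀ v →
    mapChildren h (augView G (suc l) v) ≡ node (map (λ p → toℕ (bport v p) , f (nbr v p)) (allFin (deg v)))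
  mapChildren-augView h f h≗f v = cong node (trans (sym (map-∘ (allFin (deg v))))
    (map-cong (λ p → cong (toℕ (bport v p) ,_) (h≗f (nbr v p))) (allFin (deg v))))

  truncate-augView : ∀ l v → truncate l (augView G (suc l) v) ≡ augView G l v
  truncate-augView zero    v = cong dleaf (trans (length-map _ (allFin (deg v))) (length-tabulate id))
  truncate-augView (suc l) v = mapChildren-augView (truncate l) (augView G l) (truncate-augView l) v

  eraseLabels-augView : ∀ l v → eraseLabels l (augView G l v) ≡ view G l v
  eraseLabels-augView zero    v = refl
  eraseLabels-augView (suc l) v = mapChildren-augView (eraseLabels l) (view G l) (eraseLabels-augView l) v

  infix 4 _∼[_]_
  _∼[_]_ : Fin n → ℕ → Fin n → Set
  u ∼[ l ] v = augView G l u ≡ augView G l v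

  ∼-pred : u ∼[ suc l ] v → u ∼[ l ] v
  ∼-pred {l = l} = cong-through (truncate l) (truncate-augView l)

  ∼-antimono : l ≤ m → u ∼[ m ] v → u ∼[ l ] v
  ∼-antimono = go ∘ ℕ.≤⇒≤′
    where
    go : l ≤′ m → u ∼[ m ] v → u ∼[ l ] v
    go ℕ.≤′-refl       = id
    go (ℕ.≤′-step l≤m) = go l≤m ∘ ∼-pred

  Stable : ℕ → Set
  Stable l = ∀ {u v} → u ∼[ l ] v → u ∼[ suc l ] v

  -- Stability makes B^(l+1) a function of B^l, hence B^(l+2) one of B^(l+1).
  stable-suc : Stable l → Stable (suc l)
  stable-suc {l} stable =
    cong-through (mapChildren extend) (mapChildren-augView extend (augView G (suc l)) extend-augView)
    where
    extend : Tree → Tree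
    extend t with owner? l t
    ... | yes (w , _) = augView G (suc l) w
    ... | no _        = leaf

    extend-augView : ∀ w → extend (augView G l w) ≡ augView G (suc l) w
    extend-augView w with owner? l (augView G l w)
    ... | yes (w′ , w′∼w) = stable w′∼w
    ... | no ¬owner       = contradiction (w , refl) ¬owner

  stable-mono : Stable l → l ≤ m → Stable m
  stable-mono {l} stable = go ∘ ℕ.≤⇒≤′
    where
    go : ∀ {m} → l ≤′ m → Stable m
    go ℕ.≤′-refl       = stable
    go (ℕ.≤′-step l≤m) = stable-suc (go l≤m)

  ∼-stable : Stable l → l ≤ m → u ∼[ l ] v → u ∼[ m ] v
  ∼-stable {l} {u = u} {v} stable = go ∘ ℕ.≤⇒≤′
    where
    go : ∀ {m} → l ≤′ m → u ∼[ l ] v → u ∼[ m ] v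
    go ℕ.≤′-refl       = id
    go (ℕ.≤′-step l≤m) = stable-mono stable (ℕ.≤′⇒≤ l≤m) ∘ go l≤m

  stable⇒augDistinct : Feasible G → Stable l → AugDistinct G l
  stable⇒augDistinct {l} feasible stable u v u∼v = feasible u v λ m →
    cong-through (eraseLabels m) (eraseLabels-augView m)
      (∼-antimono (ℕ.m≤m⊔n m l) (∼-stable stable (ℕ.m≤n⊔m m l) u∼v))

  pairs : List (Fin n × Fin n)
  pairs = cartesianProduct (allFin n) (allFin n)

  similar? : ∀ l (x : Fin n × Fin n) → Dec (proj₁ x ∼[ l ] proj₂ x)
  similar? l (u , v) = augView G l u ≟ᵀ augView G l v

  #similar : ℕ → ℕ
  #similar l = length (filter (similar? l) pairs)

  #similar-suc-≤ : ∀ l → #similar (suc l) ≤ #similar l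
  #similar-suc-≤ l = length-filter-mono (similar? l) (similar? (suc l)) ∼-pred pairs

  #similar-suc-≡⇒stable : #similar (suc l) ≡ #similar l → Stable l
  #similar-suc-≡⇒stable {l} #≡ {u} {v} = length-filter-≡⇒⊇ (similar? l) (similar? (suc l)) ∼-pred #≡
    (∈-cartesianProduct⁺ (∈-allFin u) (∈-allFin v))

  stable-level : ∀ k l → #similar l ≤ k → ∃ Stable
  stable-level k l #≤k with #similar (suc l) ℕ.≟ #similar l
  ... | yes #≡ = l , #similar-suc-≡⇒stable #≡
  ... | no #≢ with k | ℕ.<-≤-trans (ℕ.≤∧≢⇒< (#similar-suc-≤ l) #≢) #≤k
  ...   | zero  | ()
  ...   | suc k | #<1+k = stable-level k (suc l) (ℕ.≤-pred #<1+k)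

  augDistinct-exists : Feasible G → ∃ (AugDistinct G)
  augDistinct-exists feasible with stable-level (#similar 0) 0 ℕ.≤-refl
  ... | l , stable = l , stable⇒augDistinct feasible stable

  augDistinct? : ∀ l → Dec (AugDistinct G l)
  augDistinct? l = all? λ u → all? λ v → (augView G l u ≟ᵀ augView G l v) →-dec (u Fin.≟ v)

  module _ (A : Algorithm) where
    open Algorithm A

    stateFromAugView-augView : ∀ r v → stateFromAugView A r (augView G r v) ≡ stateAt G A r v
    stateFromAugView-augView zero    v = refl
    stateFromAugView-augView (suc r) v = cong₂ receive
      (trans (cong (stateFromAugView A r) (truncate-augView r v)) (stateFromAugView-augView r v))
      (trans (sym (map-∘ (allFin (deg v))))
        (map-cong (λ p → cong (λ s → send s (toℕ (bport v p))) (stateFromAugView-augView r (nbr v p)))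
                  (allFin (deg v))))

    ∼⇒stateAt-≡ : u ∼[ r ] v → stateAt G A r u ≡ stateAt G A r v
    ∼⇒stateAt-≡ {r = r} = cong-through (stateFromAugView A r) (stateFromAugView-augView r)

    sameStates⇒sameOutput : ∀ {r₁ r₂ o₁ o₂} →
      (∀ {r} → r ≤ t → stateAt G A r u ≡ stateAt G A r v) → r₁ ≤ t → r₂ ≤ t →
      OutputsAt G A u r₁ o₁ → OutputsAt G A v r₂ o₂ → o₁ ≡ o₂
    sameStates⇒sameOutput {r₁ = r₁} {r₂} same r₁≤t r₂≤t (out₁ , first₁) (out₂ , first₂)
      with ℕ.<-cmp r₁ r₂
    ... | tri< r₁<r₂ _ _ =
      contradiction (trans (sym out₁) (trans (cong output (same r₁≤t)) (first₂ r₁ r₁<r₂))) λ ()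
    ... | tri≈ _ refl _  =
      just-injective (trans (sym out₁) (trans (cong output (same r₁≤t)) out₂))
    ... | tri> _ _ r₂<r₁ =
      contradiction (trans (sym out₂) (trans (cong output (sym (same r₂≤t))) (first₁ r₂ r₂<r₁))) λ ()

  nbr-cong : u ≡ v → (p : Fin (deg u)) (p′ : Fin (deg v)) → toℕ p ≡ toℕ p′ → nbr u p ≡ nbr v p′
  nbr-cong {u} refl p p′ p≡p′ = cong (nbr u) (toℕ-injective p≡p′)

  -- Each step records the port of arrival, so a path can be walked backwards.
  portPath-start-unique : ∀ {ps ps′ vs vs′} → PortPath G u ps vs w → PortPath G v ps′ vs′ w →
                          ps ≡ ps′ → u ≡ v
  portPath-start-unique stop stop _ = refl
  portPath-start-unique {u} {v = v} (step p path) (step p′ path′) ps≡ps′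
    with (p≡p′ , ps≡ps′) ← ∷-injective ps≡ps′ = begin
      u                                ≡⟨ nbr-back u p ⟨
      nbr (nbr u p) (bport u p)        ≡⟨ nbr-cong (portPath-start-unique path path′ ps≡ps′)
                                            (bport u p) (bport v p′) (cong proj₂ p≡p′) ⟩
      nbr (nbr v p′) (bport v p′)      ≡⟨ nbr-back v p′ ⟩
      v                                ∎
    where open ≡-Reasoning

  simplePath-suffix : ∀ {ps vs} → PortPath G u ps vs w → Unique vs → v ∈ vs →
                      ∃[ ps′ ] SimplePathTo G v ps′ w
  simplePath-suffix stop          unique       (here refl)  = _ , _ , stop , unique
  simplePath-suffix (step p path) unique       (here refl)  = _ , _ , step p path , unique
  simplePath-suffix (step p path) (_ ∷ unique) (there v∈vs) = simplePath-suffix path unique v∈vs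

  reach⇒simplePath : Reach G v w → ∃[ ps ] SimplePathTo G v ps w
  reach⇒simplePath here = _ , _ , stop , All.[] ∷ []
  reach⇒simplePath {v} (step p reach) with reach⇒simplePath reach
  ... | _ , vs , path , unique with _∈?_ Fin._≟_ v vs
  ...   | yes v∈vs = simplePath-suffix path unique v∈vs
  ...   | no v∉vs  = _ , _ , step p path , ¬Any⇒All¬ vs v∉vs ∷ unique

  electsWithin⇒augDistinct : (A : Algorithm) → ElectsWithin G A t → AugDistinct G t
  electsWithin⇒augDistinct A (leader , elects) u v u∼v with elects u | elects v
  ... | _ , _ , r₁≤t , out₁ , _ , path₁ , _ | _ , _ , r₂≤t , out₂ , _ , path₂ , _ =
    portPath-start-unique path₁ path₂
      (sameStates⇒sameOutput A (λ r≤t → ∼⇒stateAt-≡ A (∼-antimono r≤t u∼v)) r₁≤t r₂≤t out₁ out₂)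

  -- After l rounds every node knows B^l(v), which identifies v in the map.
  module Election (connected : Connected G) (leader : Fin n) (distinct : AugDistinct G l) where

    pathToLeader : Fin n → List (ℕ × ℕ)
    pathToLeader v = proj₁ (reach⇒simplePath (connected v leader))

    announce : ℕ → Tree → Maybe (List (ℕ × ℕ))
    announce r t with r ℕ.≟ l | owner? l t
    ... | yes _ | yes (w , _) = just (pathToLeader w)
    ... | _     | _           = nothing

    algorithm : Algorithm
    algorithm = record
      { State   = ℕ × Tree
      ; Msg     = ℕ × Tree
      ; init    = λ d → 0 , dleaf d
      ; send    = λ s q → q , proj₂ s
      ; receive = λ s ms → suc (proj₁ s) , node ms
      ; output  = λ s → announce (proj₁ s) (proj₂ s)
      }

    stateAt-algorithm : ∀ r v → stateAt G algorithm r v ≡ (r , augView G r v)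
    stateAt-algorithm zero    v = refl
    stateAt-algorithm (suc r) v = cong₂ _,_ (cong (suc ∘ proj₁) (stateAt-algorithm r v))
      (cong node (map-cong (λ p → cong (toℕ (bport v p) ,_) (cong proj₂ (stateAt-algorithm r (nbr v p))))
                           (allFin (deg v))))

    announce-augView : ∀ v → announce l (augView G l v) ≡ just (pathToLeader v)
    announce-augView v with l ℕ.≟ l | owner? l (augView G l v)
    ... | yes _   | yes (w , w∼v) = cong (just ∘ pathToLeader) (distinct w v w∼v)
    ... | yes _   | no ¬owner     = contradiction (v , refl) ¬owner
    ... | no l≢l  | _             = contradiction refl l≢l

    announce-early : ∀ {r} t → r < l → announce r t ≡ nothing
    announce-early {r} t r<l with r ℕ.≟ l | owner? l t
    ... | yes refl | _ = contradiction r<l (ℕ.<-irrefl refl)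
    ... | no _     | _ = refl

    elects : ElectsWithin G algorithm l
    elects = leader , λ v → l , pathToLeader v , ℕ.≤-refl ,
      ( trans (cong output (stateAt-algorithm l v)) (announce-augView v)
      , λ r r<l → trans (cong output (stateAt-algorithm r v)) (announce-early (augView G r v) r<l) ) ,
      proj₂ (reach⇒simplePath (connected v leader))
      where open Algorithm algorithm

proposition1 : (G : PortGraph) → 3 ≤ PortGraph.n G → Simple G → Connected G →
    Feasible G →
    ∃[ l ] (LeastAugDistinct G l × ElectionIndexIs G l)
proposition1 G 3≤n _ connected feasible
  with least-witness (augDistinct? G) (proj₂ (augDistinct-exists G feasible))
... | l , least@(distinct , minimal) =
  l , least , (algorithm , elects) , λ A t el → minimal t (electsWithin⇒augDistinct G A el)
  where open Election G connected (Fin.fromℕ< (ℕ.<-≤-trans (s≤s z≤n) 3≤n)) distinct
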